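{- Let $n\ge 3$ and $\alpha,\beta\in(0,\infty)$. Let $S_{n,\alpha,\beta}$ be a random $\alpha/\beta$-staircase tableau of size $n$. Conditioned on the event $S_{n,\alpha,\beta}(n-1,1)=\alpha$, the subtableau $S_{n,\alpha,\beta}[1,3]$ (obtained by deleting the first two columns) has the same distribution as $S_{n-2,\alpha,\beta}$, i.e. \[\mathcal{L}\big(S_{n,\alpha,\beta}[1,3]\ \big|\ S_{n,\alpha,\beta}(n-1,1)=\alpha\big)=\mathcal{L}(S_{n-2,\alpha,\beta}).\]
   Context: A staircase tableau of size $n$ is a Young diagram of shape $(n,n-1,\dots,1)$ (row $i$ has boxes $(i,j)$, $1\le j\le n-i+1$; rows numbered top to bottom, columns left to right, so $i+j\le n+1$) whose boxes are empty or contain a symbol, such that: all boxes in the same column and above an $\alpha$ (or $\gamma$) are empty; all boxes in the same row and to the left of a $\beta$ (or $\delta$) are empty; every box on the main diagonal (boxes $(i,j)$ with $i+j=n+1$) contains a symbol. An $\alpha/\beta$-staircase tableau uses only the symbols $\alpha$ and $\beta$. Its weight is $wt(S)=\alpha^{N_\alpha}\beta^{N_\beta}$, where $N_\alpha,N_\beta$ are the numbers of $\alpha$'s and $\beta$'s. For parameters $\alpha,\beta$, the random tableau $S_{n,\alpha,\beta}$ takes value $S$ in the set of $\alpha/\beta$-staircase tableaux of size $n$ with probability $wt(S)/Z_n(\alpha,\beta)$, where $Z_n(\alpha,\beta)=\sum_S wt(S)$. $S(i,j)$ denotes the content of box $(i,j)$. For a box $(i,j)$, $S[i,j]$ denotes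 the staircase tableau of size $n-i-j+2$ obtained from $S$ by deleting the first $i-1$ rows and first $j-1$ columns. -}

module Defs where

open import Data.Bool using (Bool; true; false; _∧_; not; if_then_else_)
open import Data.Nat using (ℕ; zero; suc; _+_; _∸_; _≤ᵇ_; _<ᵇ_; _≡ᵇ_)
open import Data.List using (List; []; _∷_; map; concatMap; length; drop; take; foldr; applyUpTo)
open import Data.Maybe using (Maybe; nothing; just)
open import Algebra.Bundles using (CommutativeSemiring)

data Sym : Set where
  sα sβ : Sym

Cell : Set
Cell = Maybe Sym

-- A filling is given by its rows, top to bottom; row i is listed left to right.
-- For size n, row i (1-indexed) has n - i + 1 boxes.
Filling : Set
Filling = List (List Cell)

_==S_ : Sym → Sym → Bool
sα ==S sα = true
sβ ==S sβ = true
_  ==S _  = false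

_==C_ : Cell → Cell → Bool
nothing ==C nothing = true
just a  ==C just b  = a ==S b
_       ==C _       = false

_==R_ : List Cell → List Cell → Bool
[]       ==R []       = true
(x ∷ xs) ==R (y ∷ ys) = (x ==C y) ∧ (xs ==R ys)
_        ==R _        = false

_==F_ : Filling → Filling → Bool
[]       ==F []       = true
(x ∷ xs) ==F (y ∷ ys) = (x ==R y) ∧ (xs ==F ys)
_        ==F _        = false

isEmpty : Cell → Bool
isEmpty nothing  = true
isEmpty (just _) = false

isα : Cell → Bool
isα (just sα) = true
isα _         = false

isβ : Cell → Bool
isβ (just sβ) = true
isβ _         = false

-- 1-indexed list access (nothing when out of range)
nth : {A : Set} → List A → ℕ → Maybe A
nth []       _             = nothing
nth (x ∷ xs) zero          = nothing
nth (x ∷ xs) (suc zero)    = just x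
nth (x ∷ xs) (suc (suc k)) = nth xs (suc k)

-- S(i,j), content of box (i,j) (1-indexed); boxes outside the diagram read as empty
cellAt : Filling → ℕ → ℕ → Cell
cellAt S i j with nth S i
... | nothing = nothing
... | just r with nth r j
...   | nothing = nothing
...   | just c  = c

shapeOK : ℕ → Filling → Bool
shapeOK zero    []       = true
shapeOK zero    (_ ∷ _)  = false
shapeOK (suc m) []       = false
shapeOK (suc m) (r ∷ rs) = (length r ≡ᵇ suc m) ∧ shapeOK m rs

all : {A : Set} → (A → Bool) → List A → Bool
all p []       = true
all p (x ∷ xs) = p x ∧ all p xs

range1 : ℕ → List ℕ
range1 k = applyUpTo suc k

record Box : Set where
  constructor box
  field row col : ℕ

boxes : ℕ → List Box
boxes n = concatMap (λ i → map (λ j → box i j) (range1 (suc n ∸ i))) (range1 n)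

diagOK : ℕ → Filling → Bool
diagOK n S = all (λ i → not (isEmpty (cellAt S i (suc n ∸ i)))) (range1 n)

colOK : ℕ → Filling → Bool
colOK n S = all (λ b → let i = Box.row b ; j = Box.col b in
                 if isα (cellAt S i j)
                 then all (λ i' → isEmpty (cellAt S i' j)) (range1 (i ∸ 1))
                 else true) (boxes n)

rowOK : ℕ → Filling → Bool
rowOK n S = all (λ b → let i = Box.row b ; j = Box.col b in
                 if isβ (cellAt S i j)
                 then all (λ j' → isEmpty (cellAt S i j')) (range1 (j ∸ 1))
                 else true) (boxes n)

isStaircase : ℕ → Filling → Bool
isStaircase n S = shapeOK n S ∧ diagOK n S ∧ colOK n S ∧ rowOK n S

cellValues : List Cell
cellValues = nothing ∷ just sα ∷ just sβ ∷ []

rowsOfLength : ℕ → List (List Cell)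
rowsOfLength zero    = [] ∷ []
rowsOfLength (suc m) = concatMap (λ c → map (c ∷_) (rowsOfLength m)) cellValues

shapeFillings : ℕ → List Filling
shapeFillings zero    = [] ∷ []
shapeFillings (suc m) = concatMap (λ r → map (r ∷_) (shapeFillings m)) (rowsOfLength (suc m))

-- Subtableau S[i,j]: delete the first i-1 rows and first j-1 columns;
-- result is a staircase of size n - i - j + 2.

subtab : ℕ → Filling → ℕ → ℕ → Filling
subtab n S i j = map (drop (j ∸ 1)) (take (n + 2 ∸ (i + j)) (drop (i ∸ 1) S))

module Weights {c ℓ} (R : CommutativeSemiring c ℓ) (α β : CommutativeSemiring.Carrier R) where
  open CommutativeSemiring R using (Carrier; 0#; 1#) renaming (_+_ to _⊕_; _*_ to _⊛_)

  cellWt : Cell → Carrier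
  cellWt nothing   = 1#
  cellWt (just sα) = α
  cellWt (just sβ) = β

  wt : Filling → Carrier
  wt S = foldr (λ r acc → foldr (λ x a → cellWt x ⊛ a) 1# r ⊛ acc) 1# S

  weightOf : ℕ → (Filling → Bool) → Carrier
  weightOf n E = foldr (λ S acc → (if isStaircase n S ∧ E S then wt S else 0#) ⊕ acc) 0# (shapeFillings n)

  Z : ℕ → Carrier
  Z n = weightOf n (λ _ → true)

-- If S(n-1,1) = α, that α empties column 1 above it.  The diagonal box (n-1,2) cannot hold a β,
-- which would empty the α to its left, so it holds an α and empties column 2 above it; the diagonal
-- box (n,1) cannot hold an α, which would empty box (n-1,1), so it holds a β.  Conversely, these
-- two columns next to any staircase tableau of size n-2 form a staircase tableau of size n.  So
-- S ↦ S[1,3] is a bijection from the event S(n-1,1) = α onto staircase tableaux of size n-2 with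
-- wt(S) = α²β·wt(S[1,3]); summing over the enumeration of fillings gives
-- W(S(n-1,1) = α ∧ S[1,3] = T) = α²β·wt(T) and W(S(n-1,1) = α) = α²β·Z_{n-2}.

module Submission where

open import Defs
open import Data.Bool using (Bool; true; false; _∧_; not; if_then_else_)
open import Data.Bool.Properties using (∧-assoc; ∧-comm; ∧-identityʳ; ∧-zeroʳ; ∧-conicalˡ; ∧-conicalʳ; ⇔→≡; T-≡)
open import Data.Nat using (ℕ; zero; suc; _+_; _∸_; _≤_; _<_; _≡ᵇ_; z≤n; s≤s; z<s; s<s; s<s⁻¹)
open import Data.Nat.Properties
  using (m≤n+m; ≤-<-trans; <-trans; ≤-reflexive; m+n∸n≡m; +-comm; suc-injective;
         m+n≤o⇒m≤o∸n; m≤o∸n⇒m+n≤o; <⇒≤; ≤-refl; n≤1+n; n<1+n; m≤n⇒∃[o]m+o≡n; m<1+n⇒m<n∨m≡n; ≡ᵇ⇒≡)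
open import Data.List using (List; []; _∷_; _++_; map; concatMap; foldr; length; drop; take)
open import Data.List.Relation.Unary.All using (All; []; _∷_)
open import Data.List.Relation.Unary.All.Properties using (concat⁺; concat⁻; map⁺; map⁻; applyUpTo⁺₁; applyUpTo⁻)
open import Data.Maybe using (nothing; just; maybe; fromMaybe)
open import Data.Product using (_×_; _,_)
open import Data.Sum using (inj₁; inj₂)
open import Function.Bundles using (_⇔_; mk⇔; Equivalence)
open import Relation.Nullary using (contradiction)
open import Relation.Binary.PropositionalEquality using (_≡_; _≢_; refl; sym; trans; cong; cong₂; subst)
import Relation.Binary.PropositionalEquality as P
open import Algebra.Bundles using (CommutativeSemiring)
import Algebra.Properties.CommutativeSemigroup as CommutativeSemigroupProperties
import Relation.Binary.Reasoning.Setoid as SetoidReasoning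

open Equivalence using (to; from)

∧≡true⇔ : ∀ {x y} → x ∧ y ≡ true ⇔ (x ≡ true × y ≡ true)
∧≡true⇔ {x} {y} = mk⇔ (λ h → ∧-conicalˡ x y h , ∧-conicalʳ x y h) (λ { (refl , h) → h })

if-then-true⇔ : ∀ {b x} → (if b then x else true) ≡ true ⇔ (b ≡ true → x ≡ true)
if-then-true⇔ {true}  = mk⇔ (λ h _ → h) (λ h → h refl)
if-then-true⇔ {false} = mk⇔ (λ _ ()) (λ _ → refl)

all≡true⇔ : ∀ {A : Set} (p : A → Bool) xs → all p xs ≡ true ⇔ All (λ x → p x ≡ true) xs
all≡true⇔ p []       = mk⇔ (λ _ → []) (λ _ → refl)
all≡true⇔ p (x ∷ xs) = mk⇔
  (λ h → let px , pxs = to ∧≡true⇔ h in px ∷ to (all≡true⇔ p xs) pxs)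
  (λ { (px ∷ pxs) → from ∧≡true⇔ (px , from (all≡true⇔ p xs) pxs) })

all-range1⇔ : ∀ (p : ℕ → Bool) k → all p (range1 k) ≡ true ⇔ (∀ {i} → i < k → p (suc i) ≡ true)
all-range1⇔ p k = mk⇔ (λ h {i} → applyUpTo⁻ suc k (to (all≡true⇔ p _) h) {i})
                      (λ h → from (all≡true⇔ p _) (applyUpTo⁺₁ suc k h))

m+n<o⇒n<o : ∀ {a b n} → b + a < n → a < n
m+n<o⇒n<o {a} {b} = ≤-<-trans (m≤n+m a b)

all-boxes⇔ : ∀ (p : Box → Bool) n →
             all p (boxes n) ≡ true ⇔ (∀ {a b} → b + a < n → p (box (suc a) (suc b)) ≡ true)
all-boxes⇔ p n = mk⇔
  (λ h {a} {b} b+a<n →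
    let inRow = applyUpTo⁻ suc n (map⁻ (concat⁻ (to (all≡true⇔ p _) h))) (m+n<o⇒n<o b+a<n)
    in applyUpTo⁻ suc (n ∸ a) (map⁻ inRow) (m+n≤o⇒m≤o∸n (suc b) b+a<n))
  (λ h → from (all≡true⇔ p _) (concat⁺ (map⁺ (applyUpTo⁺₁ suc n λ {a} a<n →
    map⁺ (applyUpTo⁺₁ suc (n ∸ a) λ {b} b<n∸a → h (m≤o∸n⇒m+n≤o (suc b) (<⇒≤ a<n) b<n∸a))))))

isEmpty≡true⇔ : ∀ {c} → isEmpty c ≡ true ⇔ c ≡ nothing
isEmpty≡true⇔ {nothing} = mk⇔ (λ _ → refl) (λ _ → refl)
isEmpty≡true⇔ {just _}  = mk⇔ (λ ()) (λ ())

not-isEmpty≡true⇔ : ∀ {c} → not (isEmpty c) ≡ true ⇔ c ≢ nothing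
not-isEmpty≡true⇔ {nothing} = mk⇔ (λ ()) (λ c≢nothing → contradiction refl c≢nothing)
not-isEmpty≡true⇔ {just _}  = mk⇔ (λ _ ()) (λ _ → refl)

isα≡true⇔ : ∀ {c} → isα c ≡ true ⇔ c ≡ just sα
isα≡true⇔ {nothing}   = mk⇔ (λ ()) (λ ())
isα≡true⇔ {just sα}   = mk⇔ (λ _ → refl) (λ _ → refl)
isα≡true⇔ {just sβ}   = mk⇔ (λ ()) (λ ())

isβ≡true⇔ : ∀ {c} → isβ c ≡ true ⇔ c ≡ just sβ
isβ≡true⇔ {nothing}   = mk⇔ (λ ()) (λ ())
isβ≡true⇔ {just sα}   = mk⇔ (λ ()) (λ ())
isβ≡true⇔ {just sβ}   = mk⇔ (λ _ → refl) (λ _ → refl)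

==S⇒≡ : ∀ {s t} → (s ==S t) ≡ true → s ≡ t
==S⇒≡ {sα} {sα} _ = refl
==S⇒≡ {sβ} {sβ} _ = refl

==C⇒≡ : ∀ {c d} → (c ==C d) ≡ true → c ≡ d
==C⇒≡ {nothing} {nothing} _ = refl
==C⇒≡ {just s}  {just t}  h = cong just (==S⇒≡ h)

==R⇒≡ : ∀ {r r'} → (r ==R r') ≡ true → r ≡ r'
==R⇒≡ {[]}    {[]}      _ = refl
==R⇒≡ {c ∷ r} {d ∷ r'} h = let c≡d , r≡r' = to ∧≡true⇔ h in cong₂ _∷_ (==C⇒≡ c≡d) (==R⇒≡ r≡r')

==F⇒≡ : ∀ {S T} → (S ==F T) ≡ true → S ≡ T
==F⇒≡ {[]}    {[]}      _ = refl
==F⇒≡ {r ∷ S} {r' ∷ T} h = let r≡r' , S≡T = to ∧≡true⇔ h in cong₂ _∷_ (==R⇒≡ r≡r') (==F⇒≡ S≡T)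

==S-refl : ∀ s → (s ==S s) ≡ true
==S-refl sα = refl
==S-refl sβ = refl

==C-refl : ∀ c → (c ==C c) ≡ true
==C-refl nothing  = refl
==C-refl (just s) = ==S-refl s

-- entry S a b is the paper's S(a+1, b+1); boxes outside the filling read as empty.
rowEntry : List Cell → ℕ → Cell
rowEntry r b = fromMaybe nothing (nth r (suc b))

entry : Filling → ℕ → ℕ → Cell
entry S a b = maybe (λ r → rowEntry r b) nothing (nth S (suc a))

cellAt-suc : ∀ S a b → cellAt S (suc a) (suc b) ≡ entry S a b
cellAt-suc S a b with nth S (suc a)
... | nothing = refl
... | just r with nth r (suc b)
...   | nothing = refl
...   | just c  = refl

-- Box (a+1, b+1) lies in the staircase of size n iff b + a < n, and on its diagonal iff suc (b + a) ≡ n;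
-- the column index comes first so that shifting it by two reduces definitionally.
record IsStaircase (n : ℕ) (S : Filling) : Set where
  field
    shape    : shapeOK n S ≡ true
    diagonal : ∀ {a b} → suc (b + a) ≡ n → entry S a b ≢ nothing
    column   : ∀ {a b} → b + a < n → entry S a b ≡ just sα → ∀ {a'} → a' < a → entry S a' b ≡ nothing
    row      : ∀ {a b} → b + a < n → entry S a b ≡ just sβ → ∀ {b'} → b' < b → entry S a b' ≡ nothing

diagOK⇔ : ∀ n S → diagOK n S ≡ true ⇔ (∀ {a b} → suc (b + a) ≡ n → entry S a b ≢ nothing)
diagOK⇔ n S = mk⇔ onDiagonal⇒ onDiagonal⇐
  where
  diagonalCell : ∀ {a b} → suc (b + a) ≡ n → cellAt S (suc a) (n ∸ a) ≡ entry S a b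
  diagonalCell {a} {b} refl = trans (cong (cellAt S (suc a)) (m+n∸n≡m (suc b) a)) (cellAt-suc S a b)

  onDiagonal⇒ : diagOK n S ≡ true → ∀ {a b} → suc (b + a) ≡ n → entry S a b ≢ nothing
  onDiagonal⇒ h e = to not-isEmpty≡true⇔
    (subst (λ c → not (isEmpty c) ≡ true) (diagonalCell e) (to (all-range1⇔ _ n) h (m+n<o⇒n<o (≤-reflexive e))))

  onDiagonal⇐ : (∀ {a b} → suc (b + a) ≡ n → entry S a b ≢ nothing) → diagOK n S ≡ true
  onDiagonal⇐ h = from (all-range1⇔ _ n) λ {a} a<n →
    let b , a+b≡n = m≤n⇒∃[o]m+o≡n a<n
        e = trans (cong suc (+-comm b a)) a+b≡n
    in subst (λ c → not (isEmpty c) ≡ true) (sym (diagonalCell e)) (from not-isEmpty≡true⇔ (h e))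

colOK⇔ : ∀ n S → colOK n S ≡ true ⇔
         (∀ {a b} → b + a < n → entry S a b ≡ just sα → ∀ {a'} → a' < a → entry S a' b ≡ nothing)
colOK⇔ n S = mk⇔ emptyAbove⇒ emptyAbove⇐
  where
  emptyAbove⇒ : colOK n S ≡ true →
                ∀ {a b} → b + a < n → entry S a b ≡ just sα → ∀ {a'} → a' < a → entry S a' b ≡ nothing
  emptyAbove⇒ h {a} {b} b+a<n α {a'} a'<a =
    let αHere = from isα≡true⇔ (trans (cellAt-suc S a b) α)
        above = to (all-range1⇔ _ a) (to if-then-true⇔ (to (all-boxes⇔ _ n) h b+a<n) αHere) a'<a
    in trans (sym (cellAt-suc S a' b)) (to isEmpty≡true⇔ above)

  emptyAbove⇐ : (∀ {a b} → b + a < n → entry S a b ≡ just sα → ∀ {a'} → a' < a → entry S a' b ≡ nothing) →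
                colOK n S ≡ true
  emptyAbove⇐ h = from (all-boxes⇔ _ n) λ {a} {b} b+a<n → from if-then-true⇔ λ αHere →
    from (all-range1⇔ _ a) λ {a'} a'<a → from isEmpty≡true⇔
      (trans (cellAt-suc S a' b) (h b+a<n (trans (sym (cellAt-suc S a b)) (to isα≡true⇔ αHere)) a'<a))

rowOK⇔ : ∀ n S → rowOK n S ≡ true ⇔
         (∀ {a b} → b + a < n → entry S a b ≡ just sβ → ∀ {b'} → b' < b → entry S a b' ≡ nothing)
rowOK⇔ n S = mk⇔ emptyLeft⇒ emptyLeft⇐
  where
  emptyLeft⇒ : rowOK n S ≡ true →
               ∀ {a b} → b + a < n → entry S a b ≡ just sβ → ∀ {b'} → b' < b → entry S a b' ≡ nothing
  emptyLeft⇒ h {a} {b} b+a<n β {b'} b'<b =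
    let βHere = from isβ≡true⇔ (trans (cellAt-suc S a b) β)
        left  = to (all-range1⇔ _ b) (to if-then-true⇔ (to (all-boxes⇔ _ n) h b+a<n) βHere) b'<b
    in trans (sym (cellAt-suc S a b')) (to isEmpty≡true⇔ left)

  emptyLeft⇐ : (∀ {a b} → b + a < n → entry S a b ≡ just sβ → ∀ {b'} → b' < b → entry S a b' ≡ nothing) →
               rowOK n S ≡ true
  emptyLeft⇐ h = from (all-boxes⇔ _ n) λ {a} {b} b+a<n → from if-then-true⇔ λ βHere →
    from (all-range1⇔ _ b) λ {b'} b'<b → from isEmpty≡true⇔
      (trans (cellAt-suc S a b') (h b+a<n (trans (sym (cellAt-suc S a b)) (to isβ≡true⇔ βHere)) b'<b))

isStaircase⇔ : ∀ n S → isStaircase n S ≡ true ⇔ IsStaircase n S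
isStaircase⇔ n S = mk⇔
  (λ h → let sh , h₁ = to ∧≡true⇔ h ; dg , h₂ = to ∧≡true⇔ h₁ ; cl , rw = to ∧≡true⇔ h₂
         in record { shape = sh ; diagonal = to (diagOK⇔ n S) dg
                   ; column = to (colOK⇔ n S) cl ; row = to (rowOK⇔ n S) rw })
  (λ st → let open IsStaircase st in
         from ∧≡true⇔ (shape , from ∧≡true⇔ (from (diagOK⇔ n S) diagonal ,
           from ∧≡true⇔ (from (colOK⇔ n S) column , from (rowOK⇔ n S) row))))

dropTwoColumns : ℕ → Filling → Filling
dropTwoColumns m S = map (drop 2) (take m S)

subtab-1-3 : ∀ m S → subtab (2 + m) S 1 3 ≡ dropTwoColumns m S
subtab-1-3 m S = cong (λ k → map (drop 2) (take k S)) (m+n∸n≡m m 2)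

entry-dropTwoColumns : ∀ {m a} S b → a < m → entry (dropTwoColumns m S) a b ≡ entry S a (2 + b)
entry-dropTwoColumns {suc m} []      b _ = refl
entry-dropTwoColumns {suc m} {zero}  (r ∷ S) b _ = rowEntry-drop r
  where
  rowEntry-drop : ∀ r → rowEntry (drop 2 r) b ≡ rowEntry r (2 + b)
  rowEntry-drop []          = refl
  rowEntry-drop (_ ∷ [])    = refl
  rowEntry-drop (_ ∷ _ ∷ _) = refl
entry-dropTwoColumns {suc m} {suc a} (r ∷ S) b a<m = entry-dropTwoColumns S b (s<s⁻¹ a<m)

shapeOK-dropTwoColumns : ∀ m S → shapeOK (2 + m) S ≡ true → shapeOK m (dropTwoColumns m S) ≡ true
shapeOK-dropTwoColumns zero    S                 _ = refl
shapeOK-dropTwoColumns (suc m) ((_ ∷ _ ∷ _) ∷ S) h =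
  let lengthOK , rest = to ∧≡true⇔ h in from ∧≡true⇔ (lengthOK , shapeOK-dropTwoColumns m S rest)

dropTwoColumns-isStaircase : ∀ m S → IsStaircase (2 + m) S → IsStaircase m (dropTwoColumns m S)
dropTwoColumns-isStaircase m S st = record
  { shape    = shapeOK-dropTwoColumns m S shape
  ; diagonal = λ {a} {b} e → subst (_≢ nothing) (sym (entry-dropTwoColumns S b (m+n<o⇒n<o (≤-reflexive e))))
                                   (diagonal (cong (2 +_) e))
  ; column   = λ {a} {b} b+a<m α {a'} a'<a →
      trans (entry-dropTwoColumns S b (<-trans a'<a (m+n<o⇒n<o b+a<m)))
            (column (s≤s (s≤s b+a<m)) (trans (sym (entry-dropTwoColumns S b (m+n<o⇒n<o b+a<m))) α) a'<a)
  ; row      = λ {a} {b} b+a<m β {b'} b'<b →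
      trans (entry-dropTwoColumns S b' (m+n<o⇒n<o b+a<m))
            (row (s≤s (s≤s b+a<m)) (trans (sym (entry-dropTwoColumns S b (m+n<o⇒n<o b+a<m))) β) (s≤s (s≤s b'<b)))
  }
  where open IsStaircase st

corner : Filling
corner = (just sα ∷ just sα ∷ []) ∷ (just sβ ∷ []) ∷ []

leftColumnsForced : ℕ → Filling → Bool
leftColumnsForced zero    S                               = S ==F corner
leftColumnsForced (suc m) ((nothing ∷ nothing ∷ _) ∷ S) = leftColumnsForced m S
leftColumnsForced (suc m) _                               = false

record LeftColumnsForced (m : ℕ) (S : Filling) : Set where
  field
    empty₀ : ∀ {a} → a < m → entry S a 0 ≡ nothing
    empty₁ : ∀ {a} → a < m → entry S a 1 ≡ nothing
    α₀     : entry S m 0 ≡ just sα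
    α₁     : entry S m 1 ≡ just sα
    β₀     : entry S (suc m) 0 ≡ just sβ

leftColumnsForced-sound : ∀ m S → leftColumnsForced m S ≡ true → LeftColumnsForced m S
leftColumnsForced-sound zero S h with ==F⇒≡ {S} h
... | refl = record { empty₀ = λ () ; empty₁ = λ () ; α₀ = refl ; α₁ = refl ; β₀ = refl }
leftColumnsForced-sound (suc m) ((nothing ∷ nothing ∷ _) ∷ S) h = record
  { empty₀ = λ { {zero} _ → refl ; {suc a} a<m → empty₀ (s<s⁻¹ a<m) }
  ; empty₁ = λ { {zero} _ → refl ; {suc a} a<m → empty₁ (s<s⁻¹ a<m) }
  ; α₀ = α₀ ; α₁ = α₁ ; β₀ = β₀ }
  where open LeftColumnsForced (leftColumnsForced-sound m S h)

leftColumnsForced-complete : ∀ m S → shapeOK (2 + m) S ≡ true → LeftColumnsForced m S → leftColumnsForced m S ≡ true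
leftColumnsForced-complete zero S sh F = isCorner S sh α₀ α₁ β₀
  where
  open LeftColumnsForced F
  -- every other filling fails the shape test or one of the three entries, so those clauses are absurd
  isCorner : ∀ S → shapeOK 2 S ≡ true → entry S 0 0 ≡ just sα → entry S 0 1 ≡ just sα → entry S 1 0 ≡ just sβ →
             (S ==F corner) ≡ true
  isCorner ((just sα ∷ just sα ∷ []) ∷ (just sβ ∷ []) ∷ []) _ _ _ _ = refl
leftColumnsForced-complete (suc m) ((_ ∷ _ ∷ _) ∷ S) sh F
  with LeftColumnsForced.empty₀ F z<s | LeftColumnsForced.empty₁ F z<s
... | refl | refl = leftColumnsForced-complete m S (∧-conicalʳ _ _ sh) record
  { empty₀ = λ a<m → empty₀ (s<s a<m) ; empty₁ = λ a<m → empty₁ (s<s a<m)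
  ; α₀ = α₀ ; α₁ = α₁ ; β₀ = β₀ }
  where open LeftColumnsForced F

shapeOK-undropTwoColumns : ∀ m S → leftColumnsForced m S ≡ true → shapeOK m (dropTwoColumns m S) ≡ true →
                           shapeOK (2 + m) S ≡ true
shapeOK-undropTwoColumns zero    S h _ with ==F⇒≡ {S} h
... | refl = refl
shapeOK-undropTwoColumns (suc m) ((nothing ∷ nothing ∷ _) ∷ S) h sh =
  let lengthOK , rest = to ∧≡true⇔ sh in from ∧≡true⇔ (lengthOK , shapeOK-undropTwoColumns m S h rest)

αCorner⇒leftColumnsForced : ∀ m S → IsStaircase (2 + m) S → entry S m 0 ≡ just sα → LeftColumnsForced m S
αCorner⇒leftColumnsForced m S st α₀ = record
  { empty₀ = column {m} {0} (n≤1+n (suc m)) α₀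
  ; empty₁ = column {m} {1} ≤-refl α₁
  ; α₀ = α₀ ; α₁ = α₁ ; β₀ = β₀ }
  where
  open IsStaircase st

  α₁ : entry S m 1 ≡ just sα
  α₁ with entry S m 1 in e
  ... | nothing = contradiction e (diagonal {m} {1} refl)
  ... | just sα = refl
  ... | just sβ = contradiction (trans (sym (row {m} {1} ≤-refl e z<s)) α₀) λ ()

  β₀ : entry S (suc m) 0 ≡ just sβ
  β₀ with entry S (suc m) 0 in e
  ... | nothing = contradiction e (diagonal {suc m} {0} refl)
  ... | just sα = contradiction (trans (sym (column {suc m} {0} ≤-refl e (n<1+n m))) α₀) λ ()
  ... | just sβ = refl

leftColumnsForced⇒staircase : ∀ m S → LeftColumnsForced m S → shapeOK (2 + m) S ≡ true →
                              IsStaircase m (dropTwoColumns m S) → IsStaircase (2 + m) S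
leftColumnsForced⇒staircase m S F sh st = record { shape = sh ; diagonal = diagonal′ ; column = column′ ; row = row′ }
  where
  open LeftColumnsForced F
  open IsStaircase st

  conflict : ∀ {c s t} {A : Set} → c ≡ just s → c ≡ t → t ≢ just s → A
  conflict c≡s c≡t t≢s = contradiction (trans (sym c≡t) c≡s) t≢s

  fromDropped : ∀ {a b} → a < m → entry S a (2 + b) ≡ entry (dropTwoColumns m S) a b
  fromDropped {a} {b} a<m = sym (entry-dropTwoColumns S b a<m)

  diagonal′ : ∀ {a b} → suc (b + a) ≡ 2 + m → entry S a b ≢ nothing
  diagonal′ {a} {zero} e with suc-injective e
  ... | refl = λ empty → conflict β₀ empty λ ()
  diagonal′ {a} {suc zero} e with suc-injective (suc-injective e)
  ... | refl = λ empty → conflict α₁ empty λ ()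
  diagonal′ {a} {suc (suc b)} e =
    let e′ = suc-injective (suc-injective e) in
    subst (_≢ nothing) (sym (fromDropped (m+n<o⇒n<o (≤-reflexive e′)))) (diagonal e′)

  column′ : ∀ {a b} → b + a < 2 + m → entry S a b ≡ just sα → ∀ {a'} → a' < a → entry S a' b ≡ nothing
  column′ {a} {zero} a<2+m α {a'} a'<a with m<1+n⇒m<n∨m≡n a<2+m
  ... | inj₂ refl = conflict β₀ α λ ()
  ... | inj₁ a<1+m with m<1+n⇒m<n∨m≡n a<1+m
  ...   | inj₁ a<m  = conflict α (empty₀ a<m) λ ()
  ...   | inj₂ refl = empty₀ a'<a
  column′ {a} {suc zero} 1+a<2+m α {a'} a'<a with m<1+n⇒m<n∨m≡n (s<s⁻¹ 1+a<2+m)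
  ... | inj₁ a<m  = conflict α (empty₁ a<m) λ ()
  ... | inj₂ refl = empty₁ a'<a
  column′ {a} {suc (suc b)} lt α {a'} a'<a =
    let b+a<m = s<s⁻¹ (s<s⁻¹ lt) ; a<m = m+n<o⇒n<o b+a<m in
    trans (fromDropped (<-trans a'<a a<m)) (column b+a<m (trans (sym (fromDropped a<m)) α) a'<a)

  row′ : ∀ {a b} → b + a < 2 + m → entry S a b ≡ just sβ → ∀ {b'} → b' < b → entry S a b' ≡ nothing
  row′ {a} {suc zero} 1+a<2+m β {zero} _ with m<1+n⇒m<n∨m≡n (s<s⁻¹ 1+a<2+m)
  ... | inj₁ a<m  = conflict β (empty₁ a<m) λ ()
  ... | inj₂ refl = conflict β α₁ λ ()
  row′ {a} {suc zero} _ _ {suc b'} (s<s ())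
  row′ {a} {suc (suc b)} lt β {zero}          _ = empty₀ (m+n<o⇒n<o (s<s⁻¹ (s<s⁻¹ lt)))
  row′ {a} {suc (suc b)} lt β {suc zero}      _ = empty₁ (m+n<o⇒n<o (s<s⁻¹ (s<s⁻¹ lt)))
  row′ {a} {suc (suc b)} lt β {suc (suc b')} b'<b =
    let b+a<m = s<s⁻¹ (s<s⁻¹ lt) ; a<m = m+n<o⇒n<o b+a<m in
    trans (fromDropped a<m) (row b+a<m (trans (sym (fromDropped a<m)) β) (s<s⁻¹ (s<s⁻¹ b'<b)))

staircase∧αCorner≡ : ∀ m S → (isStaircase (2 + m) S ∧ isα (cellAt S (suc m) 1))
                             ≡ (leftColumnsForced m S ∧ isStaircase m (dropTwoColumns m S))
staircase∧αCorner≡ m S = ⇔→≡ (mk⇔ fromCorner toCorner)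
  where
  αCorner⇔ : isα (cellAt S (suc m) 1) ≡ true ⇔ entry S m 0 ≡ just sα
  αCorner⇔ = subst (λ c → isα (cellAt S (suc m) 1) ≡ true ⇔ c ≡ just sα) (cellAt-suc S m 0) isα≡true⇔

  fromCorner : isStaircase (2 + m) S ∧ isα (cellAt S (suc m) 1) ≡ true →
               leftColumnsForced m S ∧ isStaircase m (dropTwoColumns m S) ≡ true
  fromCorner h =
    let stair , α = to ∧≡true⇔ h
        st = to (isStaircase⇔ (2 + m) S) stair
        F = αCorner⇒leftColumnsForced m S st (to αCorner⇔ α)
    in from ∧≡true⇔ ( leftColumnsForced-complete m S (IsStaircase.shape st) F
                    , from (isStaircase⇔ m _) (dropTwoColumns-isStaircase m S st))

  toCorner : leftColumnsForced m S ∧ isStaircase m (dropTwoColumns m S) ≡ true →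
             isStaircase (2 + m) S ∧ isα (cellAt S (suc m) 1) ≡ true
  toCorner h =
    let forced , stair = to ∧≡true⇔ h
        st = to (isStaircase⇔ m _) stair
        F = leftColumnsForced-sound m S forced
        sh = shapeOK-undropTwoColumns m S forced (IsStaircase.shape st)
    in from ∧≡true⇔ ( from (isStaircase⇔ (2 + m) S) (leftColumnsForced⇒staircase m S F sh st)
                    , from αCorner⇔ (LeftColumnsForced.α₀ F))

module FiniteSums {c ℓ} (R : CommutativeSemiring c ℓ) where
  open CommutativeSemiring R
    renaming (_+_ to _⊕_; _*_ to _⊛_; refl to ≈-refl; sym to ≈-sym; trans to ≈-trans; reflexive to ≈-reflexive)
  open SetoidReasoning setoid

  sum : {A : Set} → (A → Carrier) → List A → Carrier
  sum f = foldr (λ x acc → f x ⊕ acc) 0#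

  sum-cong : ∀ {A : Set} {f g : A → Carrier} xs → (∀ x → f x ≈ g x) → sum f xs ≈ sum g xs
  sum-cong []       _   = ≈-refl
  sum-cong (x ∷ xs) f≈g = +-cong (f≈g x) (sum-cong xs f≈g)

  sum-zero : ∀ {A : Set} {f : A → Carrier} xs → (∀ x → f x ≈ 0#) → sum f xs ≈ 0#
  sum-zero []       _   = ≈-refl
  sum-zero (x ∷ xs) f≈0 = ≈-trans (+-cong (f≈0 x) (sum-zero xs f≈0)) (+-identityˡ 0#)

  sum-++ : ∀ {A : Set} (f : A → Carrier) xs ys → sum f (xs ++ ys) ≈ sum f xs ⊕ sum f ys
  sum-++ f []       ys = ≈-sym (+-identityˡ _)
  sum-++ f (x ∷ xs) ys = ≈-trans (+-congˡ (sum-++ f xs ys)) (≈-sym (+-assoc _ _ _))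

  *-distribˡ-sum : ∀ {A : Set} k (f : A → Carrier) xs → k ⊛ sum f xs ≈ sum (λ x → k ⊛ f x) xs
  *-distribˡ-sum k f []       = zeroʳ k
  *-distribˡ-sum k f (x ∷ xs) = ≈-trans (distribˡ k _ _) (+-congˡ (*-distribˡ-sum k f xs))

  sum-cons-product : ∀ {A : Set} (f : List A → Carrier) xs ys →
                     sum f (concatMap (λ x → map (x ∷_) ys) xs) ≈ sum (λ x → sum (λ y → f (x ∷ y)) ys) xs
  sum-cons-product f []       ys = ≈-refl
  sum-cons-product f (x ∷ xs) ys = begin
    sum f (map (x ∷_) ys ++ concatMap (λ x → map (x ∷_) ys) xs)      ≈⟨ sum-++ f (map (x ∷_) ys) _ ⟩
    sum f (map (x ∷_) ys) ⊕ sum f (concatMap (λ x → map (x ∷_) ys) xs) ≈⟨ +-cong (≈-reflexive (sum-map ys))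
                                                                                   (sum-cons-product f xs ys) ⟩
    sum (λ y → f (x ∷ y)) ys ⊕ sum (λ x → sum (λ y → f (x ∷ y)) ys) xs ∎
    where
    sum-map : ∀ ys → sum f (map (x ∷_) ys) ≡ sum (λ y → f (x ∷ y)) ys
    sum-map []       = P.refl
    sum-map (y ∷ ys) = P.cong (f (x ∷ y) ⊕_) (sum-map ys)

  if-⊛ : ∀ b x y → (if b then x ⊛ y else 0#) ≈ x ⊛ (if b then y else 0#)
  if-⊛ true  x y = ≈-refl
  if-⊛ false x y = ≈-sym (zeroʳ x)

  sum-if-∧ : ∀ {A : Set} a (p : A → Bool) (f : A → Carrier) xs →
             sum (λ x → if a ∧ p x then f x else 0#) xs ≈ (if a then sum (λ x → if p x then f x else 0#) xs else 0#)
  sum-if-∧ true  p f xs = ≈-refl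
  sum-if-∧ false p f xs = sum-zero xs (λ _ → ≈-refl)

  zero+zero : ∀ {x y} → x ≈ 0# → y ≈ 0# → x ⊕ y ≈ 0#
  zero+zero x≈0 y≈0 = ≈-trans (+-cong x≈0 y≈0) (+-identityˡ 0#)

  sum-cellValues-at : ∀ c₀ (h : Cell → Carrier) → (∀ c → (c ==C c₀) ≡ false → h c ≈ 0#) → sum h cellValues ≈ h c₀
  sum-cellValues-at nothing h z =
    ≈-trans (+-congˡ (zero+zero (z _ P.refl) (zero+zero (z _ P.refl) ≈-refl))) (+-identityʳ _)
  sum-cellValues-at (just sα) h z =
    ≈-trans (+-cong (z _ P.refl) (+-congˡ (zero+zero (z _ P.refl) ≈-refl))) (≈-trans (+-identityˡ _) (+-identityʳ _))
  sum-cellValues-at (just sβ) h z =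
    ≈-trans (+-cong (z _ P.refl) (+-cong (z _ P.refl) ≈-refl))
            (≈-trans (+-identityˡ _) (≈-trans (+-identityˡ _) (+-identityʳ _)))

  sum-rowsOfLength-== : ∀ {k} r₀ → length r₀ ≡ k → (g : List Cell → Carrier) →
                        sum (λ r → if r ==R r₀ then g r else 0#) (rowsOfLength k) ≈ g r₀
  sum-rowsOfLength-== []        P.refl g = +-identityʳ (g [])
  sum-rowsOfLength-== (c₀ ∷ r₀) P.refl g = begin
    sum (λ r → if r ==R (c₀ ∷ r₀) then g r else 0#) (rowsOfLength (suc (length r₀)))
      ≈⟨ sum-cons-product _ cellValues rows ⟩
    sum (λ c → sum (λ r → if (c ==C c₀) ∧ (r ==R r₀) then g (c ∷ r) else 0#) rows) cellValues
      ≈⟨ sum-cong cellValues (λ c → sum-if-∧ (c ==C c₀) (_==R r₀) (λ r → g (c ∷ r)) rows) ⟩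
    sum (λ c → if c ==C c₀ then inner c else 0#) cellValues
      ≈⟨ sum-cellValues-at c₀ _ (λ c c≢c₀ → ≈-reflexive (P.cong (λ b → if b then inner c else 0#) c≢c₀)) ⟩
    (if c₀ ==C c₀ then inner c₀ else 0#)
      ≡⟨ P.cong (λ b → if b then inner c₀ else 0#) (==C-refl c₀) ⟩
    inner c₀
      ≈⟨ sum-rowsOfLength-== r₀ P.refl (λ r → g (c₀ ∷ r)) ⟩
    g (c₀ ∷ r₀) ∎
    where
    rows : List (List Cell)
    rows = rowsOfLength (length r₀)

    inner : Cell → Carrier
    inner c = sum (λ r → if r ==R r₀ then g (c ∷ r) else 0#) rows

  sum-shapeFillings-== : ∀ k T → shapeOK k T ≡ true → (f : Filling → Carrier) →
                         sum (λ U → if U ==F T then f U else 0#) (shapeFillings k) ≈ f T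
  sum-shapeFillings-== zero    []       _  f = +-identityʳ (f [])
  sum-shapeFillings-== (suc k) (r₀ ∷ T) sh f = begin
    sum (λ U → if U ==F (r₀ ∷ T) then f U else 0#) (shapeFillings (suc k))
      ≈⟨ sum-cons-product _ (rowsOfLength (suc k)) (shapeFillings k) ⟩
    sum (λ r → sum (λ U → if (r ==R r₀) ∧ (U ==F T) then f (r ∷ U) else 0#) (shapeFillings k)) (rowsOfLength (suc k))
      ≈⟨ sum-cong (rowsOfLength (suc k)) (λ r → sum-if-∧ (r ==R r₀) (_==F T) (λ U → f (r ∷ U)) (shapeFillings k)) ⟩
    sum (λ r → if r ==R r₀ then inner r else 0#) (rowsOfLength (suc k))
      ≈⟨ sum-rowsOfLength-== r₀ (≡ᵇ⇒≡ (length r₀) (suc k) (from T-≡ lengthOK)) inner ⟩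
    inner r₀
      ≈⟨ sum-shapeFillings-== k T rest (λ U → f (r₀ ∷ U)) ⟩
    f (r₀ ∷ T) ∎
    where
    lengthOK : (length r₀ ≡ᵇ suc k) ≡ true
    lengthOK = ∧-conicalˡ _ _ sh

    rest : shapeOK k T ≡ true
    rest = ∧-conicalʳ _ _ sh

    inner : List Cell → Carrier
    inner r = sum (λ U → if U ==F T then f (r ∷ U) else 0#) (shapeFillings k)

module WeightedSums {c ℓ} (R : CommutativeSemiring c ℓ) (α β : CommutativeSemiring.Carrier R) where
  open CommutativeSemiring R
    renaming (_+_ to _⊕_; _*_ to _⊛_; refl to ≈-refl; sym to ≈-sym; trans to ≈-trans; reflexive to ≈-reflexive)
  open Weights R α β
  open FiniteSums R
  open SetoidReasoning setoid
  open CommutativeSemigroupProperties *-commutativeSemigroup using (x∙yz≈y∙xz)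

  rowWt : List Cell → Carrier
  rowWt = foldr (λ x a → cellWt x ⊛ a) 1#

  sum-leftColumnsForced : ∀ m (P : Filling → Bool) →
    sum (λ S → if leftColumnsForced m S ∧ P (dropTwoColumns m S) then wt S else 0#) (shapeFillings (2 + m))
    ≈ wt corner ⊛ sum (λ U → if P U then wt U else 0#) (shapeFillings m)
  sum-leftColumnsForced zero P = begin
    sum (λ S → if (S ==F corner) ∧ P [] then wt S else 0#) (shapeFillings 2)
      ≈⟨ sum-cong (shapeFillings 2) (λ S →
           ≈-reflexive (P.cong (λ b → if b then wt S else 0#) (∧-comm (S ==F corner) (P [])))) ⟩
    sum (λ S → if P [] ∧ (S ==F corner) then wt S else 0#) (shapeFillings 2)
      ≈⟨ sum-if-∧ (P []) (_==F corner) wt (shapeFillings 2) ⟩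
    (if P [] then sum (λ S → if S ==F corner then wt S else 0#) (shapeFillings 2) else 0#)
      ≈⟨ onlyCorner (P []) ⟩
    wt corner ⊛ ((if P [] then 1# else 0#) ⊕ 0#) ∎
    where
    onlyCorner : ∀ b → (if b then sum (λ S → if S ==F corner then wt S else 0#) (shapeFillings 2) else 0#)
                       ≈ wt corner ⊛ ((if b then 1# else 0#) ⊕ 0#)
    onlyCorner true  = ≈-trans (sum-shapeFillings-== 2 corner P.refl wt)
                               (≈-sym (≈-trans (*-congˡ (+-identityʳ 1#)) (*-identityʳ _)))
    onlyCorner false = ≈-sym (≈-trans (*-congˡ (+-identityʳ 0#)) (zeroʳ _))
  sum-leftColumnsForced (suc m) P = begin
    sum g (shapeFillings (3 + m))
      ≈⟨ sum-cons-product g (rowsOfLength (3 + m)) (shapeFillings (2 + m)) ⟩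
    sum (λ r → sum (λ S → g (r ∷ S)) (shapeFillings (2 + m))) (rowsOfLength (3 + m))
      ≈⟨ sum-cons-product _ cellValues (rowsOfLength (2 + m)) ⟩
    sum firstCell cellValues
      ≈⟨ sum-cellValues-at nothing firstCell
           (onlyEmpty λ _ → sum-zero (rowsOfLength (2 + m)) λ _ → sum-zero (shapeFillings (2 + m)) λ _ → ≈-refl) ⟩
    firstCell nothing
      ≈⟨ sum-cons-product _ cellValues (rowsOfLength (1 + m)) ⟩
    sum secondCell cellValues
      ≈⟨ sum-cellValues-at nothing secondCell
           (onlyEmpty λ _ → sum-zero (rowsOfLength (1 + m)) λ _ → sum-zero (shapeFillings (2 + m)) λ _ → ≈-refl) ⟩
    secondCell nothing
      ≈⟨ sum-cong (rowsOfLength (1 + m)) dropFirstRow ⟩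
    sum (λ t → wt corner ⊛ (rowWt t ⊛ rest t)) (rowsOfLength (1 + m))
      ≈⟨ *-distribˡ-sum (wt corner) _ (rowsOfLength (1 + m)) ⟨
    wt corner ⊛ sum (λ t → rowWt t ⊛ rest t) (rowsOfLength (1 + m))
      ≈⟨ *-congˡ splitFirstRow ⟨
    wt corner ⊛ sum (λ U → if P U then wt U else 0#) (shapeFillings (1 + m)) ∎
    where
    g : Filling → Carrier
    g S = if leftColumnsForced (suc m) S ∧ P (dropTwoColumns (suc m) S) then wt S else 0#

    firstCell : Cell → Carrier
    firstCell c = sum (λ r → sum (λ S → g ((c ∷ r) ∷ S)) (shapeFillings (2 + m))) (rowsOfLength (2 + m))

    secondCell : Cell → Carrier
    secondCell c = sum (λ t → sum (λ S → g ((nothing ∷ c ∷ t) ∷ S)) (shapeFillings (2 + m))) (rowsOfLength (1 + m))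

    rest : List Cell → Carrier
    rest t = sum (λ U → if P (t ∷ U) then wt U else 0#) (shapeFillings m)

    onlyEmpty : ∀ {h : Cell → Carrier} → (∀ s → h (just s) ≈ 0#) → ∀ c → (c ==C nothing) ≡ false → h c ≈ 0#
    onlyEmpty h≈0 (just s) _ = h≈0 s

    dropFirstRow : ∀ t → sum (λ S → g ((nothing ∷ nothing ∷ t) ∷ S)) (shapeFillings (2 + m))
                         ≈ wt corner ⊛ (rowWt t ⊛ rest t)
    dropFirstRow t = begin
      sum (λ S → if leftColumnsForced m S ∧ P (t ∷ dropTwoColumns m S) then w ⊛ wt S else 0#) (shapeFillings (2 + m))
        ≈⟨ sum-cong (shapeFillings (2 + m)) (λ S → if-⊛ _ w (wt S)) ⟩
      sum (λ S → w ⊛ (if leftColumnsForced m S ∧ P (t ∷ dropTwoColumns m S) then wt S else 0#)) (shapeFillings (2 + m))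
        ≈⟨ *-distribˡ-sum w _ (shapeFillings (2 + m)) ⟨
      w ⊛ sum (λ S → if leftColumnsForced m S ∧ P (t ∷ dropTwoColumns m S) then wt S else 0#) (shapeFillings (2 + m))
        ≈⟨ *-congˡ (sum-leftColumnsForced m (λ U → P (t ∷ U))) ⟩
      w ⊛ (wt corner ⊛ rest t)
        ≈⟨ *-congʳ (≈-trans (*-identityˡ _) (*-identityˡ _)) ⟩
      rowWt t ⊛ (wt corner ⊛ rest t)
        ≈⟨ x∙yz≈y∙xz (rowWt t) (wt corner) (rest t) ⟩
      wt corner ⊛ (rowWt t ⊛ rest t) ∎
      where
      w : Carrier
      w = rowWt (nothing ∷ nothing ∷ t)

    splitFirstRow : sum (λ U → if P U then wt U else 0#) (shapeFillings (1 + m))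
                    ≈ sum (λ t → rowWt t ⊛ rest t) (rowsOfLength (1 + m))
    splitFirstRow = ≈-trans (sum-cons-product _ (rowsOfLength (1 + m)) (shapeFillings m))
      (sum-cong (rowsOfLength (1 + m)) λ t → ≈-trans (sum-cong (shapeFillings m) λ U → if-⊛ (P (t ∷ U)) (rowWt t) (wt U))
                                                     (≈-sym (*-distribˡ-sum (rowWt t) _ (shapeFillings m))))

  -- weightOf n E unfolds to sum (λ S → if isStaircase n S ∧ E S then wt S else 0#) (shapeFillings n).
  weightOf-cong : ∀ n {E E′ : Filling → Bool} → (∀ S → E S ≡ E′ S) → weightOf n E ≈ weightOf n E′
  weightOf-cong n E≡E′ = sum-cong (shapeFillings n) λ S →
    ≈-reflexive (P.cong (λ b → if isStaircase n S ∧ b then wt S else 0#) (E≡E′ S))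

  weightOf-==F : ∀ m T → isStaircase m T ≡ true → weightOf m (_==F T) ≈ wt T
  weightOf-==F m T stair = begin
    weightOf m (_==F T)
      ≈⟨ sum-cong (shapeFillings m) (λ U → ≈-reflexive (P.cong (λ b → if b then wt U else 0#) (staircase∧==F U))) ⟩
    sum (λ U → if U ==F T then wt U else 0#) (shapeFillings m)
      ≈⟨ sum-shapeFillings-== m T (∧-conicalˡ _ _ stair) wt ⟩
    wt T ∎
    where
    staircase∧==F : ∀ U → isStaircase m U ∧ (U ==F T) ≡ (U ==F T)
    staircase∧==F U with U ==F T in eq
    ... | false = ∧-zeroʳ _
    ... | true  = P.trans (∧-identityʳ _) (P.subst (λ V → isStaircase m V ≡ true) (P.sym (==F⇒≡ eq)) stair)

  weightOf-αCorner : ∀ m (Q : Filling → Bool) →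
    weightOf (2 + m) (λ S → isα (cellAt S (suc m) 1) ∧ Q (subtab (2 + m) S 1 3)) ≈ wt corner ⊛ weightOf m Q
  weightOf-αCorner m Q = ≈-trans (sum-cong (shapeFillings (2 + m)) λ S →
      ≈-reflexive (P.cong (λ b → if b then wt S else 0#) (event≡ S)))
    (sum-leftColumnsForced m (λ U → isStaircase m U ∧ Q U))
    where
    event≡ : ∀ S → isStaircase (2 + m) S ∧ (isα (cellAt S (suc m) 1) ∧ Q (subtab (2 + m) S 1 3))
                   ≡ leftColumnsForced m S ∧ (isStaircase m (dropTwoColumns m S) ∧ Q (dropTwoColumns m S))
    event≡ S rewrite subtab-1-3 m S =
      P.trans (P.sym (∧-assoc (isStaircase (2 + m) S) _ (Q U)))
              (P.trans (P.cong (_∧ Q U) (staircase∧αCorner≡ m S)) (∧-assoc (leftColumnsForced m S) _ (Q U)))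
      where
      U : Filling
      U = dropTwoColumns m S

lemma3p1 : ∀ {c ℓ} (R : CommutativeSemiring c ℓ) (α β : CommutativeSemiring.Carrier R)
           (n : ℕ) → 3 ≤ n → (T : Filling) → isStaircase (n ∸ 2) T ≡ true →
           let open CommutativeSemiring R
               open Weights R α β
           in weightOf n (λ S → isα (cellAt S (n ∸ 1) 1) ∧ (subtab n S 1 3 ==F T)) * Z (n ∸ 2)
              ≈ wt T * weightOf n (λ S → isα (cellAt S (n ∸ 1) 1))
lemma3p1 R α β (suc (suc (suc k))) (s≤s (s≤s (s≤s z≤n))) T stair = begin
  weightOf n (λ S → αCorner S ∧ (subtab n S 1 3 ==F T)) ⊛ Z m  ≈⟨ *-congʳ (weightOf-αCorner m (_==F T)) ⟩
  (wt corner ⊛ weightOf m (_==F T)) ⊛ Z m                      ≈⟨ *-congʳ (*-congˡ (weightOf-==F m T stair)) ⟩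
  (wt corner ⊛ wt T) ⊛ Z m                                      ≈⟨ xy∙z≈y∙xz (wt corner) (wt T) (Z m) ⟩
  wt T ⊛ (wt corner ⊛ Z m)                                      ≈⟨ *-congˡ (weightOf-αCorner m (λ _ → true)) ⟨
  wt T ⊛ weightOf n (λ S → αCorner S ∧ true)                    ≈⟨ *-congˡ (weightOf-cong n (λ S → ∧-identityʳ _)) ⟩
  wt T ⊛ weightOf n αCorner                                     ∎
  where
  open CommutativeSemiring R using (setoid; *-congˡ; *-congʳ; *-commutativeSemigroup) renaming (_*_ to _⊛_)
  open Weights R α β
  open WeightedSums R α β
  open SetoidReasoning setoid
  open CommutativeSemigroupProperties *-commutativeSemigroup using (xy∙z≈y∙xz)

  m : ℕ
  m = suc k

  n : ℕ
  n = 2 + m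

  αCorner : Filling → Bool
  αCorner S = isα (cellAt S (suc m) 1)
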